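{- Let $(A,B,C)$ be a nontrivial solution triple of $A!\,B!=C!$ and put $k=C-B$. If $k\in\{2,3,\dots,20\}$, then $$B=\left\lceil (A!)^{1/k}-\frac{k+1}{2}\right\rceil.$$
   Context: A nontrivial solution triple of the equation $A!\,B!=C!$ is a triple of positive integers $(A,B,C)$ with $A\le B\le C-2$ satisfying $A!\,B!=C!$. $\lceil x\rceil$ denotes the smallest integer $\ge x$. -}

module Defs where

open import Data.Nat using (ℕ; _+_; _*_; _∸_; _^_; _≤_; _<_; _!)
open import Relation.Binary.PropositionalEquality using (_≡_)
open import Data.Product using (_×_)

NontrivialSolution : ℕ → ℕ → ℕ → Set
NontrivialSolution A B C =
  (1 ≤ A) × (A ≤ B) × (B + 2 ≤ C) × (A ! * B ! ≡ C !)

-- IsCeilRootShift n m k  expresses  n = ⌈ m^(1/k) - (k+1)/2 ⌉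
-- (for n ≥ 1, k ≥ 1, m ≥ 1), with no real numbers:
--   n = ⌈y⌉  ⇔  n - 1 < y ≤ n,  y = m^(1/k) - (k+1)/2
--   ⇔  2n + k - 1 < 2 m^(1/k) ≤ 2n + k + 1
--   ⇔  (2n + k - 1)^k < 2^k m ≤ (2n + k + 1)^k
-- (the last step since both bounds are positive for n ≥ 1, and t ↦ t^k
-- is strictly increasing on nonnegative reals).
IsCeilRootShift : ℕ → ℕ → ℕ → Set
IsCeilRootShift n m k =
  ((2 * n + k ∸ 1) ^ k < 2 ^ k * m) × (2 ^ k * m ≤ (2 * n + k + 1) ^ k)

{-# OPTIONS --safe #-}
-- Cancelling B! gives A! = (B+1)(B+2)⋯(B+k), so k < A ≤ B, and
-- 2^k A! = (2B+2)(2B+4)⋯(2B+2k) is a product of k factors in arithmetic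
-- progression with mean 2B+k+1. Pairing the i-th factor with the i-th from the
-- end, each pair is at most (2B+k+1)² (AM–GM), and at least (2B+k-1)² as soon as
-- (k-1)² ≤ 4(2B+k); for k ≤ 20 this holds once B ≥ 46, and the finitely many
-- remaining cases are checked by evaluation.
module Submission where

open import Defs
open import Data.Nat using (ℕ; _∸_; _≤_; _!)
open import Data.Nat
  using (zero; suc; _+_; _*_; _^_; _<_; _<?_; z≤n; s≤s; z<s; s≤s⁻¹; >-nonZero; allUpTo?)
open import Data.Nat.Properties
open import Data.Nat.Tactic.RingSolver using (solve)
open import Data.List using (_∷_; [])
open import Data.Product using (_,_)
open import Relation.Nullary using (Dec; yes; no)
open import Relation.Nullary.Decidable using (toWitness; _→-dec_)
open import Relation.Binary.PropositionalEquality
open import Algebra.Properties.CommutativeSemigroup *-commutativeSemigroup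
  using (interchange; x∙yz≈xz∙y; x∙yz≈y∙zx)

arithProd : ℕ → ℕ → ℕ → ℕ
arithProd a d zero    = 1
arithProd a d (suc k) = (a + d) * arithProd (a + d) d k

arithProd-snoc : ∀ a d k → arithProd a d (suc k) ≡ arithProd a d k * (a + suc k * d)
arithProd-snoc a d zero    = begin
  (a + d) * 1 ≡⟨ solve (a ∷ d ∷ []) ⟩ 1 * (a + 1 * d) ∎
  where open ≡-Reasoning
arithProd-snoc a d (suc k) = begin
  (a + d) * arithProd (a + d) d (suc k)
    ≡⟨ cong ((a + d) *_) (arithProd-snoc (a + d) d k) ⟩
  (a + d) * (arithProd (a + d) d k * (a + d + suc k * d))
    ≡⟨ *-assoc (a + d) _ _ ⟨
  (a + d) * arithProd (a + d) d k * (a + d + suc k * d)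
    ≡⟨ cong ((a + d) * arithProd (a + d) d k *_) (+-assoc a d (suc k * d)) ⟩
  (a + d) * arithProd (a + d) d k * (a + suc (suc k) * d) ∎
  where open ≡-Reasoning

arithProd-outer : ∀ a d k →
  arithProd a d (2 + k) ≡ (a + d) * (a + d + suc k * d) * arithProd (a + d) d k
arithProd-outer a d k = begin
  (a + d) * arithProd (a + d) d (suc k)
    ≡⟨ cong ((a + d) *_) (arithProd-snoc (a + d) d k) ⟩
  (a + d) * (arithProd (a + d) d k * (a + d + suc k * d))
    ≡⟨ x∙yz≈xz∙y (a + d) _ _ ⟩
  (a + d) * (a + d + suc k * d) * arithProd (a + d) d k ∎
  where open ≡-Reasoning

^-*-arithProd : ∀ c a d k → c ^ k * arithProd a d k ≡ arithProd (c * a) (c * d) k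
^-*-arithProd c a d zero    = refl
^-*-arithProd c a d (suc k) = begin
  c * c ^ k * ((a + d) * arithProd (a + d) d k)
    ≡⟨ interchange c (c ^ k) (a + d) _ ⟩
  c * (a + d) * (c ^ k * arithProd (a + d) d k)
    ≡⟨ cong₂ _*_ (*-distribˡ-+ c a d) (^-*-arithProd c (a + d) d k) ⟩
  (c * a + c * d) * arithProd (c * (a + d)) (c * d) k
    ≡⟨ cong (λ x → (c * a + c * d) * arithProd x (c * d) k) (*-distribˡ-+ c a d) ⟩
  (c * a + c * d) * arithProd (c * a + c * d) (c * d) k ∎
  where open ≡-Reasoning

[m+k]!≡m!*arithProd : ∀ m k → (m + k) ! ≡ m ! * arithProd m 1 k
[m+k]!≡m!*arithProd m zero    = trans (cong _! (+-identityʳ m)) (sym (*-identityʳ (m !)))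
[m+k]!≡m!*arithProd m (suc k) = begin
  (m + suc k) !                             ≡⟨ cong _! (+-suc m k) ⟩
  suc (m + k) * (m + k) !                   ≡⟨ cong (suc (m + k) *_) ([m+k]!≡m!*arithProd m k) ⟩
  suc (m + k) * (m ! * arithProd m 1 k)     ≡⟨ x∙yz≈y∙zx (suc (m + k)) (m !) _ ⟩
  m ! * (arithProd m 1 k * suc (m + k))     ≡⟨ cong (λ x → m ! * (arithProd m 1 k * x)) last-factor ⟨
  m ! * (arithProd m 1 k * (m + suc k * 1)) ≡⟨ cong (m ! *_) (arithProd-snoc m 1 k) ⟨
  m ! * arithProd m 1 (suc k) ∎
  where
  open ≡-Reasoning
  last-factor : m + suc k * 1 ≡ suc (m + k)
  last-factor = trans (cong (m +_) (*-identityʳ (suc k))) (+-suc m k)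

arithProd-pos : ∀ a {d} k → 0 < d → 0 < arithProd a d k
arithProd-pos a zero    0<d = z<s
arithProd-pos a {d} (suc k) 0<d =
  *-mono-≤ (≤-trans 0<d (m≤n+m d a)) (arithProd-pos (a + d) k 0<d)

arithProd-monoˡ-≤ : ∀ {a b} d k → a ≤ b → arithProd a d k ≤ arithProd b d k
arithProd-monoˡ-≤ d zero    a≤b = ≤-refl
arithProd-monoˡ-≤ d (suc k) a≤b =
  *-mono-≤ (+-monoˡ-≤ d a≤b) (arithProd-monoˡ-≤ d k (+-monoˡ-≤ d a≤b))

arithProd-monoˡ-< : ∀ {a b d} k → 0 < d → a < b → arithProd a d (suc k) < arithProd b d (suc k)
arithProd-monoˡ-< {a} {b} {d} k 0<d a<b = begin-strict
  (a + d) * arithProd (a + d) d k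
    <⟨ *-monoˡ-< _ {{>-nonZero (arithProd-pos (a + d) k 0<d)}} (+-monoˡ-< d a<b) ⟩
  (b + d) * arithProd (a + d) d k
    ≤⟨ *-monoʳ-≤ (b + d) (arithProd-monoˡ-≤ d k (+-monoˡ-≤ d (<⇒≤ a<b))) ⟩
  (b + d) * arithProd (b + d) d k ∎
  where open ≤-Reasoning

arithProd-monoʳ-≤ : ∀ a {d k l} → 0 < d → k ≤ l → arithProd a d k ≤ arithProd a d l
arithProd-monoʳ-≤ a {l = l} 0<d z≤n       = arithProd-pos a l 0<d
arithProd-monoʳ-≤ a {d}     0<d (s≤s k≤l) = *-monoʳ-≤ (a + d) (arithProd-monoʳ-≤ (a + d) 0<d k≤l)

*≤square-of-mean : ∀ c e → c * (c + e * 2) ≤ (c + e) * (c + e)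
*≤square-of-mean c e = begin
  c * (c + e * 2)         ≤⟨ m≤m+n _ (e * e) ⟩
  c * (c + e * 2) + e * e ≡⟨ solve (c ∷ e ∷ []) ⟩
  (c + e) * (c + e)       ∎
  where open ≤-Reasoning

-- (a + e)² + 4(a + e + 1) = (a + e + 2)² = (a + 2)(a + 2 + 2e) + e²
square-of-mean∸2≤* : ∀ a e → e * e ≤ 4 * (a + e + 1) → (a + e) * (a + e) ≤ (a + 2) * (a + 2 + e * 2)
square-of-mean∸2≤* a e e²≤ = +-cancelʳ-≤ (4 * (a + e + 1)) _ _ (begin
  (a + e) * (a + e) + 4 * (a + e + 1) ≡⟨ solve (a ∷ e ∷ []) ⟩
  (a + 2) * (a + 2 + e * 2) + e * e   ≤⟨ +-monoʳ-≤ _ e²≤ ⟩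
  (a + 2) * (a + 2 + e * 2) + 4 * (a + e + 1) ∎)
  where open ≤-Reasoning

arithProd-2-upper : ∀ a k → arithProd a 2 k ≤ (a + k + 1) ^ k
arithProd-2-upper a zero          = ≤-refl
arithProd-2-upper a (suc zero)    = ≤-reflexive (cong (_* 1) (sym (+-assoc a 1 1)))
arithProd-2-upper a (suc (suc k)) = begin
  arithProd a 2 (2 + k)                                       ≡⟨ arithProd-outer a 2 k ⟩
  (a + 2) * (a + 2 + suc k * 2) * arithProd (a + 2) 2 k
    ≤⟨ *-mono-≤ (*≤square-of-mean (a + 2) (suc k)) (arithProd-2-upper (a + 2) k) ⟩
  (a + 2 + suc k) * (a + 2 + suc k) * (a + 2 + k + 1) ^ k
    ≡⟨ cong₂ (λ x y → x * x * y ^ k) outer-mean inner-mean ⟩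
  X * X * X ^ k                                               ≡⟨ *-assoc X X (X ^ k) ⟩
  X ^ (2 + k) ∎
  where
  open ≤-Reasoning
  X : ℕ
  X = a + (2 + k) + 1
  outer-mean : a + 2 + suc k ≡ a + (2 + k) + 1
  outer-mean = solve (a ∷ k ∷ [])
  inner-mean : a + 2 + k + 1 ≡ a + (2 + k) + 1
  inner-mean = solve (a ∷ k ∷ [])

arithProd-2-lower : ∀ a n → n * n ≤ 4 * (a + n + 1) → (a + n) ^ suc n < arithProd a 2 (suc n)
arithProd-2-lower a zero          _ = *-monoˡ-< 1 (+-monoʳ-< a z<s)
arithProd-2-lower a (suc zero)    _ = begin-strict
  (a + 1) * ((a + 1) * 1)                   <⟨ m<m+n _ {suc (4 * a + 6)} z<s ⟩
  (a + 1) * ((a + 1) * 1) + suc (4 * a + 6) ≡⟨ solve (a ∷ []) ⟩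
  (a + 2) * ((a + 2 + 2) * 1)               ∎
  where open ≤-Reasoning
arithProd-2-lower a (suc (suc n)) n²≤ = begin-strict
  Y ^ (3 + n)                                               ≡⟨ *-assoc Y Y (Y ^ suc n) ⟨
  Y * Y * Y ^ suc n                                         ≡⟨ cong (λ x → Y * Y * x ^ suc n) (+-assoc a 2 n) ⟨
  Y * Y * (a + 2 + n) ^ suc n
    ≤⟨ *-monoˡ-≤ _ (square-of-mean∸2≤* a (2 + n) n²≤) ⟩
  (a + 2) * (a + 2 + suc (suc n) * 2) * (a + 2 + n) ^ suc n
    <⟨ *-monoʳ-< _ {{>-nonZero outer-pos}} (arithProd-2-lower (a + 2) n inner-n²≤) ⟩
  (a + 2) * (a + 2 + suc (suc n) * 2) * arithProd (a + 2) 2 (suc n) ≡⟨ arithProd-outer a 2 (suc n) ⟨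
  arithProd a 2 (3 + n) ∎
  where
  open ≤-Reasoning
  Y : ℕ
  Y = a + (2 + n)
  outer-pos : 0 < (a + 2) * (a + 2 + suc (suc n) * 2)
  outer-pos = *-mono-≤ 0<a+2 (≤-trans 0<a+2 (m≤m+n (a + 2) _))
    where
    0<a+2 : 0 < a + 2
    0<a+2 = ≤-trans z<s (m≤n+m 2 a)
  inner-n²≤ : n * n ≤ 4 * (a + 2 + n + 1)
  inner-n²≤ = begin
    n * n                   ≤⟨ *-mono-≤ (m≤n+m n 2) (m≤n+m n 2) ⟩
    (2 + n) * (2 + n)       ≤⟨ n²≤ ⟩
    4 * (a + (2 + n) + 1)   ≡⟨ cong (λ x → 4 * (x + 1)) (+-assoc a 2 n) ⟨
    4 * (a + 2 + n + 1)     ∎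

arithProd-2-lower-B<46 : ∀ {n B} → n < 20 → B < 46 → suc n < B →
  (2 * B + n) ^ suc n < arithProd (2 * B) 2 (suc n)
arithProd-2-lower-B<46 n<20 = toWitness {a? = all-cases?} _ n<20
  where
  all-cases? : Dec (∀ {n} → n < 20 → ∀ {B} → B < 46 → suc n < B →
                    (2 * B + n) ^ suc n < arithProd (2 * B) 2 (suc n))
  all-cases? = allUpTo? (λ n → allUpTo? (λ B →
    suc n <? B →-dec (2 * B + n) ^ suc n <? arithProd (2 * B) 2 (suc n)) 46) 20

arithProd-2-lower-n<20 : ∀ {n B} → n < 20 → suc n < B →
  (2 * B + n) ^ suc n < arithProd (2 * B) 2 (suc n)
arithProd-2-lower-n<20 {n} {B} n<20 n<B with B <? 46
... | yes B<46 = arithProd-2-lower-B<46 n<20 B<46 n<B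
... | no  B≮46 = arithProd-2-lower (2 * B) n (begin
  n * n               ≤⟨ *-mono-≤ (s≤s⁻¹ n<20) (s≤s⁻¹ n<20) ⟩
  19 * 19             ≤⟨ m≤m+n 361 7 ⟩
  4 * (2 * 46)        ≤⟨ *-monoʳ-≤ 4 (*-monoʳ-≤ 2 (≮⇒≥ B≮46)) ⟩
  4 * (2 * B)         ≤⟨ *-monoʳ-≤ 4 (≤-trans (m≤m+n (2 * B) n) (m≤m+n (2 * B + n) 1)) ⟩
  4 * (2 * B + n + 1) ∎)
  where open ≤-Reasoning

isCeilRootShift-arithProd : ∀ {B k} → 0 < k → k ≤ 20 → k < B →
  IsCeilRootShift B (arithProd B 1 k) k
isCeilRootShift-arithProd {B} {suc n} z<s k≤20 k<B = lower , upper
  where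
  scaled : 2 ^ suc n * arithProd B 1 (suc n) ≡ arithProd (2 * B) 2 (suc n)
  scaled = ^-*-arithProd 2 B 1 (suc n)
  lower : (2 * B + suc n ∸ 1) ^ suc n < 2 ^ suc n * arithProd B 1 (suc n)
  lower = subst₂ (λ x y → x ^ suc n < y) (cong (_∸ 1) (sym (+-suc (2 * B) n))) (sym scaled)
                 (arithProd-2-lower-n<20 k≤20 k<B)
  upper : 2 ^ suc n * arithProd B 1 (suc n) ≤ (2 * B + suc n + 1) ^ suc n
  upper = subst (_≤ (2 * B + suc n + 1) ^ suc n) (sym scaled) (arithProd-2-upper (2 * B) (suc n))

n!≡arithProd⇒k<n : ∀ {n b k} → n ! ≡ arithProd b 1 k → 0 < n → n ≤ b → k < n
n!≡arithProd⇒k<n {suc m} {b} {k} n!≡ z<s n≤b = ≰⇒> λ n≤k → <-irrefl refl (begin-strict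
  arithProd b 1 k        ≡⟨ n!≡ ⟨
  suc m !                ≡⟨ [m+k]!≡m!*arithProd 0 (suc m) ⟩
  1 * arithProd 0 1 (suc m) ≡⟨ *-identityˡ _ ⟩
  arithProd 0 1 (suc m)  <⟨ arithProd-monoˡ-< m z<s (≤-trans z<s n≤b) ⟩
  arithProd b 1 (suc m)  ≤⟨ arithProd-monoʳ-≤ b z<s n≤k ⟩
  arithProd b 1 k        ∎)
  where open ≤-Reasoning

m!*n!≡o!⇒m!≡arithProd : ∀ {m n o} → m ! * n ! ≡ o ! → n ≤ o → m ! ≡ arithProd n 1 (o ∸ n)
m!*n!≡o!⇒m!≡arithProd {m} {n} {o} m!n!≡o! n≤o = *-cancelˡ-≡ _ _ (n !) {{n !≢0}} (begin
  n ! * m !                   ≡⟨ *-comm (n !) (m !) ⟩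
  m ! * n !                   ≡⟨ m!n!≡o! ⟩
  o !                         ≡⟨ cong _! (m+[n∸m]≡n n≤o) ⟨
  (n + (o ∸ n)) !             ≡⟨ [m+k]!≡m!*arithProd n (o ∸ n) ⟩
  n ! * arithProd n 1 (o ∸ n) ∎)
  where open ≡-Reasoning

lemma4 : (A B C : ℕ) → NontrivialSolution A B C →
    2 ≤ C ∸ B → C ∸ B ≤ 20 →
    IsCeilRootShift B (A !) (C ∸ B)
lemma4 A B C (0<A , A≤B , B+2≤C , A!B!≡C!) 2≤k k≤20 =
  subst (λ m → IsCeilRootShift B m (C ∸ B)) (sym A!≡)
        (isCeilRootShift-arithProd (≤-trans z<s 2≤k) k≤20 (<-≤-trans k<A A≤B))
  where
  A!≡ : A ! ≡ arithProd B 1 (C ∸ B)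
  A!≡ = m!*n!≡o!⇒m!≡arithProd {A} A!B!≡C! (≤-trans (m≤m+n B 2) B+2≤C)
  k<A : C ∸ B < A
  k<A = n!≡arithProd⇒k<n A!≡ 0<A A≤B
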